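{- Define binary words $(A_n)_{n\ge3}$ by $A_3 = 001001100100$ and $A_n=\gamma(A_{n-1})$ for $n\ge4$. Then for every $n\ge3$, $A_n$ is a palindrome and has at least $n$ distinct short borders that are palindromes.
   Context: Let $\mu$ be the morphism on $\{0,1\}^*$ with $\mu(0)=01$, $\mu(1)=10$. For a word $w=axa$ where $a$ is a single letter and $x$ a possibly empty word, $\gamma(w)=a^{ -1}\mu^2(w)a^{ -1}$, i.e., the word $\mu^2(w)$ with one letter $a$ removed from the front and one from the back. A border of a word $x$ is a word $w$ with $0<|w|<|x|$ that is both a prefix and a suffix of $x$; it is short if $|w|<|x|/2$. -}

module Defs where

open import Data.Nat using (ℕ; zero; suc; _<_; _*_; _≤_; _∸_)
open import Data.List using (List; []; _∷_; _++_; reverse; length; concatMap)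
open import Data.Maybe using (Maybe; just; nothing)
open import Data.Product using (Σ; _×_; ∃-syntax)
open import Relation.Binary.PropositionalEquality using (_≡_)

data Bit : Set where
  b0 b1 : Bit

Word : Set
Word = List Bit

μ₁ : Bit → Word
μ₁ b0 = b0 ∷ b1 ∷ []
μ₁ b1 = b1 ∷ b0 ∷ []

μ : Word → Word
μ = concatMap μ₁

unprefix : Bit → Word → Maybe Word
unprefix b0 (b0 ∷ u) = just u
unprefix b1 (b1 ∷ u) = just u
unprefix _ _ = nothing

-- γ(w) = a⁻¹ μ²(w) a⁻¹ where a is the first letter of w = a x a
-- (u a⁻¹ computed as reverse (a⁻¹ (reverse u))).
-- Totalised: for w empty or when the cancellation is undefined we return [];
-- this never happens along the sequence A_n (μ²(w) begins and ends with the
-- same letters as w).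
γ : Word → Word
γ [] = []
γ (a ∷ x) with unprefix a (μ (μ (a ∷ x)))
... | nothing = []
... | just u with unprefix a (reverse u)
...   | nothing = []
...   | just v = reverse v

A3 : Word
A3 = b0 ∷ b0 ∷ b1 ∷ b0 ∷ b0 ∷ b1 ∷ b1 ∷ b0 ∷ b0 ∷ b1 ∷ b0 ∷ b0 ∷ []

-- A n for n ≥ 3 is  A' (n - 3):  A' 0 = A₃, A' (k+1) = γ (A' k)
A' : ℕ → Word
A' zero = A3
A' (suc k) = γ (A' k)

IsPalindrome : Word → Set
IsPalindrome w = reverse w ≡ w

IsPrefix : Word → Word → Set
IsPrefix w x = Σ Word λ y → w ++ y ≡ x

IsSuffix : Word → Word → Set
IsSuffix w x = Σ Word λ y → y ++ w ≡ x

IsBorder : Word → Word → Set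
IsBorder w x = (0 < length w) × (length w < length x) × IsPrefix w x × IsSuffix w x

-- short border: |w| < |x|/2, i.e. 2|w| < |x|
IsShortBorder : Word → Word → Set
IsShortBorder w x = IsBorder w x × (2 * length w < length x)

A : (n : ℕ) → 3 ≤ n → Word
A n _ = A' (n ∸ 3)

module Submission where

-- Write ā for the complement of the letter a.  The proof rests on one
-- identity: for a palindrome w = a x the two cancellations in γ succeed and
--
--     a · γ(w) · a  =  μ²(w)                                   (γ-spec)
--
-- because μ² commutes with reversal and μ²(a x) = a ā ā a μ²(x).  From
-- γ-spec we read off that γ(w) is a palindrome, that 2 + |γ(w)| = 4|w|,
-- that γ(w) begins with ā, that γ is injective on palindromes with a common
-- first letter, and that it maps palindromic prefixes to prefixes.
-- Consequently a short palindromic border u of a palindrome w yields the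
-- short palindromic border γ(u) of γ(w), of length ≥ 2; together with the
-- new one-letter border ā this turns k distinct borders into k + 1.  The
-- invariant 'Rich' packages this; A₃ is Rich with the borders 0, 00, 00100,
-- and induction on n gives lemma18.

open import Defs
open import Data.Nat using (ℕ; zero; suc; _+_; _*_; _≤_; _<_; _∸_; _<?_; z≤n; s≤s)
open import Data.Nat.Properties
  using (≤-trans; <⇒≤; +-comm; *-assoc; *-suc; *-distribˡ-+; *-monoʳ-≤; *-monoʳ-<;
         +-cancelˡ-≤; +-cancelˡ-<; m≤n+m; m∸n+n≡m; module ≤-Reasoning)
open import Data.List using (List; []; _∷_; _++_; _∷ʳ_; reverse; length; map; concat)
open import Data.List.Properties
  using (map-++; concat-++; map-∘; map-cong; map-id; reverse-++; reverse-involutive;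
         unfold-reverse; length-++; length-++-≤ˡ; length-map; length-reverse;
         ∷-injectiveˡ; ∷-injectiveʳ; ∷ʳ-injectiveˡ; ++-assoc)
open import Data.List.Relation.Unary.All using (All; []; _∷_) renaming (map to All-map)
open import Data.List.Relation.Unary.All.Properties using (map⁺)
open import Data.List.Relation.Unary.AllPairs using ([]; _∷_)
open import Data.List.Relation.Unary.Unique.Propositional using (Unique)
open import Data.Maybe using (just)
open import Data.Product using (Σ; _×_; _,_; proj₁; proj₂)
open import Function using (_∘_)
open import Relation.Nullary.Decidable using (True; toWitness)
open import Relation.Binary.PropositionalEquality

complement : Bit → Bit
complement b0 = b1
complement b1 = b0

complement-involutive : ∀ b → complement (complement b) ≡ b
complement-involutive b0 = refl
complement-involutive b1 = refl
map-complement-involutive : ∀ w → map complement (map complement w) ≡ w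
map-complement-involutive w =
  trans (sym (map-∘ w)) (trans (map-cong complement-involutive w) (map-id w))

μ-++ : ∀ xs ys → μ (xs ++ ys) ≡ μ xs ++ μ ys
μ-++ xs ys = trans (cong concat (map-++ μ₁ xs ys)) (sym (concat-++ (map μ₁ xs) (map μ₁ ys)))

μ-complement : ∀ w → μ (map complement w) ≡ map complement (μ w)
μ-complement [] = refl
μ-complement (b0 ∷ w) = cong (λ v → b1 ∷ b0 ∷ v) (μ-complement w)
μ-complement (b1 ∷ w) = cong (λ v → b0 ∷ b1 ∷ v) (μ-complement w)

-- since reverse (μ₁ b) = μ₁ (complement b), reversal of μ(w) complements w
reverse-μ : ∀ w → reverse (μ w) ≡ μ (map complement (reverse w))
reverse-μ [] = refl
reverse-μ (b ∷ w) = begin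
  reverse (μ₁ b ++ μ w)                             ≡⟨ reverse-++ (μ₁ b) (μ w) ⟩
  reverse (μ w) ++ reverse (μ₁ b)                   ≡⟨ cong₂ _++_ (reverse-μ w) (reverse-μ₁ b) ⟩
  μ (map complement (reverse w)) ++ μ (complement b ∷ [])
                                                    ≡⟨ sym (μ-++ (map complement (reverse w)) (complement b ∷ [])) ⟩
  μ (map complement (reverse w) ∷ʳ complement b)    ≡⟨ cong μ (sym (map-++ complement (reverse w) (b ∷ []))) ⟩
  μ (map complement (reverse w ∷ʳ b))               ≡⟨ cong (μ ∘ map complement) (sym (unfold-reverse b w)) ⟩
  μ (map complement (reverse (b ∷ w)))              ∎
  where
  open ≡-Reasoning
  reverse-μ₁ : ∀ b → reverse (μ₁ b) ≡ μ (complement b ∷ [])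
  reverse-μ₁ b0 = refl
  reverse-μ₁ b1 = refl

-- applying μ twice, the two complementations cancel
reverse-μ² : ∀ w → reverse (μ (μ w)) ≡ μ (μ (reverse w))
reverse-μ² w = begin
  reverse (μ (μ w))                                   ≡⟨ reverse-μ (μ w) ⟩
  μ (map complement (reverse (μ w)))                  ≡⟨ cong (μ ∘ map complement) (reverse-μ w) ⟩
  μ (map complement (μ (map complement (reverse w)))) ≡⟨ cong (μ ∘ map complement) (μ-complement (reverse w)) ⟩
  μ (map complement (map complement (μ (reverse w)))) ≡⟨ cong μ (map-complement-involutive (μ (reverse w))) ⟩
  μ (μ (reverse w))                                   ∎
  where open ≡-Reasoning

μ²-palindrome : ∀ {w} → IsPalindrome w → IsPalindrome (μ (μ w))
μ²-palindrome {w} pal = trans (reverse-μ² w) (cong (μ ∘ μ) pal)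

μ²-∷ : ∀ a x → μ (μ (a ∷ x)) ≡ a ∷ complement a ∷ complement a ∷ a ∷ μ (μ x)
μ²-∷ b0 x = refl
μ²-∷ b1 x = refl

length-μ : ∀ w → length (μ w) ≡ 2 * length w
length-μ [] = refl
length-μ (b0 ∷ w) = trans (cong (suc ∘ suc) (length-μ w)) (sym (*-suc 2 (length w)))
length-μ (b1 ∷ w) = trans (cong (suc ∘ suc) (length-μ w)) (sym (*-suc 2 (length w)))

length-μ² : ∀ w → length (μ (μ w)) ≡ 4 * length w
length-μ² w = trans (length-μ (μ w)) (trans (cong (2 *_) (length-μ w)) (sym (*-assoc 2 2 (length w))))

-- μ is injective: each letter is recovered from the first letter of its image
μ-injective : ∀ u v → μ u ≡ μ v → u ≡ v
μ-injective [] [] _ = refl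
μ-injective (b0 ∷ u) (b0 ∷ v) e = cong (b0 ∷_) (μ-injective u v (∷-injectiveʳ (∷-injectiveʳ e)))
μ-injective (b1 ∷ u) (b1 ∷ v) e = cong (b1 ∷_) (μ-injective u v (∷-injectiveʳ (∷-injectiveʳ e)))
μ-injective [] (b0 ∷ v) ()
μ-injective [] (b1 ∷ v) ()
μ-injective (b0 ∷ u) [] ()
μ-injective (b1 ∷ u) [] ()
μ-injective (b0 ∷ u) (b1 ∷ v) ()
μ-injective (b1 ∷ u) (b0 ∷ v) ()

palindrome-last : ∀ a b v → IsPalindrome (a ∷ b ∷ v) → Σ Word λ r → reverse (b ∷ v) ≡ a ∷ r
palindrome-last a b v pal with reverse (b ∷ v) in eq
... | [] with () ← trans (sym (length-reverse (b ∷ v))) (cong length eq)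
... | c ∷ r = r , cong (_∷ r) c≡a
  where
  c≡a : c ≡ a
  c≡a = ∷-injectiveˡ (trans (sym (trans (unfold-reverse a (b ∷ v)) (cong (_∷ʳ a) eq))) pal)

palindrome-inner : ∀ a g → IsPalindrome (a ∷ (g ∷ʳ a)) → IsPalindrome g
palindrome-inner a g pal = ∷ʳ-injectiveˡ (reverse g) g (∷-injectiveʳ (begin
  a ∷ (reverse g ∷ʳ a)       ≡⟨ cong (_∷ʳ a) (sym (reverse-++ g (a ∷ []))) ⟩
  reverse (g ∷ʳ a) ∷ʳ a      ≡⟨ sym (unfold-reverse a (g ∷ʳ a)) ⟩
  reverse (a ∷ (g ∷ʳ a))     ≡⟨ pal ⟩
  a ∷ (g ∷ʳ a)               ∎))
  where open ≡-Reasoning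

palindrome-prefix⇒suffix : ∀ {u w} → IsPalindrome u → IsPalindrome w → IsPrefix u w → IsSuffix u w
palindrome-prefix⇒suffix {u} {w} pu pw (y , e) = reverse y , (begin
  reverse y ++ u             ≡⟨ cong (reverse y ++_) (sym pu) ⟩
  reverse y ++ reverse u     ≡⟨ sym (reverse-++ u y) ⟩
  reverse (u ++ y)           ≡⟨ cong reverse e ⟩
  reverse w                  ≡⟨ pw ⟩
  w                          ∎)
  where open ≡-Reasoning

prefix-of-common-extension : ∀ (x r y z : Word) → x ++ r ≡ y ++ z → length y ≤ length x → IsPrefix y x
prefix-of-common-extension x r [] z _ _ = x , refl
prefix-of-common-extension (c ∷ x) r (d ∷ y) z e (s≤s le)
  with refl ← ∷-injectiveˡ e
  with t , y++t≡x ← prefix-of-common-extension x r y z (∷-injectiveʳ e) le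
  = t , cong (c ∷_) y++t≡x

-- Arithmetic of the length relation 2 + |γ w| = 4 |w|: when 2 + g = 4m and
-- 2 + h = 4n, lower bounds, (strict) order and the shortness condition
-- 2m < n transfer from m, n to g, h
quadruple-≥ : ∀ {g m} k → 2 + g ≡ 4 * m → k ≤ m → 4 * k ≤ 2 + g
quadruple-≥ k e k≤m = subst (4 * k ≤_) (sym e) (*-monoʳ-≤ 4 k≤m)

quadruple-mono-≤ : ∀ {g h m n} → 2 + g ≡ 4 * m → 2 + h ≡ 4 * n → m ≤ n → g ≤ h
quadruple-mono-≤ {g} {h} eg eh m≤n =
  +-cancelˡ-≤ 2 g h (subst₂ _≤_ (sym eg) (sym eh) (*-monoʳ-≤ 4 m≤n))

quadruple-mono-< : ∀ {g h m n} → 2 + g ≡ 4 * m → 2 + h ≡ 4 * n → m < n → g < h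
quadruple-mono-< {g} {h} eg eh m<n =
  +-cancelˡ-< 2 g h (subst₂ _<_ (sym eg) (sym eh) (*-monoʳ-< 4 m<n))

quadruple-short : ∀ {g h m n} → 2 + g ≡ 4 * m → 2 + h ≡ 4 * n → 2 * m < n → 2 * g < h
quadruple-short {g} {h} {m} {n} eg eh 2m<n =
  ≤-trans (m≤n+m (suc (2 * g)) 5) (+-cancelˡ-≤ 2 (2 + (4 + 2 * g)) h (begin
    4 + (4 + 2 * g)     ≡⟨ cong (4 +_) (sym (*-distribˡ-+ 2 2 g)) ⟩
    4 + 2 * (2 + g)     ≡⟨ cong (λ t → 4 + 2 * t) eg ⟩
    4 + 2 * (4 * m)     ≡⟨ cong (4 +_) (trans (sym (*-assoc 2 4 m)) (*-assoc 4 2 m)) ⟩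
    4 + 4 * (2 * m)     ≡⟨ sym (*-suc 4 (2 * m)) ⟩
    4 * suc (2 * m)     ≤⟨ *-monoʳ-≤ 4 2m<n ⟩
    4 * n               ≡⟨ sym eh ⟩
    2 + h               ∎))
  where open ≤-Reasoning

unprefix-self : ∀ a u → unprefix a (a ∷ u) ≡ just u
unprefix-self b0 u = refl
unprefix-self b1 u = refl

γ-unfold : ∀ a x u r → μ (μ (a ∷ x)) ≡ a ∷ u → reverse u ≡ a ∷ r → γ (a ∷ x) ≡ reverse r
γ-unfold a x u r μ²≡ rev≡ rewrite μ²≡ | unprefix-self a u | rev≡ | unprefix-self a r = refl

γ-spec : ∀ a x → IsPalindrome (a ∷ x) → a ∷ (γ (a ∷ x) ∷ʳ a) ≡ μ (μ (a ∷ x))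
γ-spec a x pal = begin
  a ∷ (γ (a ∷ x) ∷ʳ a)  ≡⟨ cong (λ g → a ∷ (g ∷ʳ a)) (γ-unfold a x u r (μ²-∷ a x) rev-u) ⟩
  a ∷ (reverse r ∷ʳ a)  ≡⟨ cong (a ∷_) (sym (unfold-reverse a r)) ⟩
  a ∷ reverse (a ∷ r)   ≡⟨ cong (λ v → a ∷ reverse v) (sym rev-u) ⟩
  a ∷ reverse (reverse u) ≡⟨ cong (a ∷_) (reverse-involutive u) ⟩
  a ∷ u                 ≡⟨ sym (μ²-∷ a x) ⟩
  μ (μ (a ∷ x))         ∎
  where
  open ≡-Reasoning
  u : Word
  u = complement a ∷ complement a ∷ a ∷ μ (μ x)
  last : Σ Word λ r → reverse u ≡ a ∷ r
  last = palindrome-last a (complement a) (complement a ∷ a ∷ μ (μ x))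
           (subst IsPalindrome (μ²-∷ a x) (μ²-palindrome pal))
  r : Word
  r = proj₁ last
  rev-u : reverse u ≡ a ∷ r
  rev-u = proj₂ last

-- γ preserves palindromes: strip the outer letters from the palindrome μ²(w)
γ-palindrome : ∀ {a x} → IsPalindrome (a ∷ x) → IsPalindrome (γ (a ∷ x))
γ-palindrome {a} {x} pal = palindrome-inner a (γ (a ∷ x))
  (subst IsPalindrome (sym (γ-spec a x pal)) (μ²-palindrome pal))

length-γ : ∀ {a x} → IsPalindrome (a ∷ x) → 2 + length (γ (a ∷ x)) ≡ 4 * length (a ∷ x)
length-γ {a} {x} pal = begin
  2 + length g                 ≡⟨ cong suc (+-comm 1 (length g)) ⟩
  suc (length g + 1)           ≡⟨ cong suc (sym (length-++ g)) ⟩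
  length (a ∷ (g ∷ʳ a))        ≡⟨ cong length (γ-spec a x pal) ⟩
  length (μ (μ (a ∷ x)))       ≡⟨ length-μ² (a ∷ x) ⟩
  4 * length (a ∷ x)           ∎
  where
  open ≡-Reasoning
  g : Word
  g = γ (a ∷ x)

γ-long : ∀ {a x} → IsPalindrome (a ∷ x) → 2 ≤ length (γ (a ∷ x))
γ-long pal = +-cancelˡ-≤ 2 2 _ (quadruple-≥ 1 (length-γ pal) (s≤s z≤n))

-- γ(a x) begins with ā, the second letter of μ²(a x)
γ-head : ∀ {a x} → IsPalindrome (a ∷ x) → IsPrefix (complement a ∷ []) (γ (a ∷ x))
γ-head {a} {x} pal = prefix-of-common-extension (γ (a ∷ x)) (a ∷ []) (complement a ∷ [])
  (complement a ∷ a ∷ μ (μ x))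
  (∷-injectiveʳ (trans (γ-spec a x pal) (μ²-∷ a x)))
  (<⇒≤ (γ-long pal))

-- γ is injective on palindromes with a common first letter (μ is injective)
γ-injective : ∀ {a x y} → IsPalindrome (a ∷ x) → IsPalindrome (a ∷ y) →
              γ (a ∷ x) ≡ γ (a ∷ y) → a ∷ x ≡ a ∷ y
γ-injective {a} {x} {y} px py e = μ-injective _ _ (μ-injective _ _ (begin
  μ (μ (a ∷ x))          ≡⟨ sym (γ-spec a x px) ⟩
  a ∷ (γ (a ∷ x) ∷ʳ a)   ≡⟨ cong (λ g → a ∷ (g ∷ʳ a)) e ⟩
  a ∷ (γ (a ∷ y) ∷ʳ a)   ≡⟨ γ-spec a y py ⟩
  μ (μ (a ∷ y))          ∎))
  where open ≡-Reasoning

γ-prefix : ∀ {a t p} → IsPalindrome (a ∷ t) → IsPalindrome (a ∷ (t ++ p)) →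
           IsPrefix (γ (a ∷ t)) (γ (a ∷ (t ++ p)))
γ-prefix {a} {t} {p} pu pw = prefix-of-common-extension (γ w) (a ∷ []) (γ u) (a ∷ μ (μ p))
  (∷-injectiveʳ (begin
    a ∷ (γ w ∷ʳ a)                ≡⟨ γ-spec a (t ++ p) pw ⟩
    μ (μ (u ++ p))                ≡⟨ cong μ (μ-++ u p) ⟩
    μ (μ u ++ μ p)                ≡⟨ μ-++ (μ u) (μ p) ⟩
    μ (μ u) ++ μ (μ p)            ≡⟨ cong (_++ μ (μ p)) (sym (γ-spec a t pu)) ⟩
    a ∷ ((γ u ∷ʳ a) ++ μ (μ p))   ≡⟨ cong (a ∷_) (++-assoc (γ u) (a ∷ []) (μ (μ p))) ⟩
    a ∷ (γ u ++ a ∷ μ (μ p))      ∎))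
  (quadruple-mono-≤ (length-γ pu) (length-γ pw) (length-++-≤ˡ u))
  where
  open ≡-Reasoning
  u w : Word
  u = a ∷ t
  w = a ∷ (t ++ p)

PalBorder : Word → Word → Set
PalBorder w u = IsShortBorder u w × IsPalindrome u

prefix-head : ∀ {c t a x} → IsPrefix (c ∷ t) (a ∷ x) → c ≡ a
prefix-head (_ , refl) = refl

γ-border : ∀ {a x u} → IsPalindrome (a ∷ x) → PalBorder (a ∷ x) u →
           PalBorder (γ (a ∷ x)) (γ u) × 2 ≤ length (γ u)
γ-border {u = []} _ (((() , _) , _) , _)
γ-border {a} {u = .a ∷ t} pw (((_ , |u|<|w| , (p , refl) , _) , short) , pu) =
  (((≤-trans (s≤s z≤n) (γ-long pu) , quadruple-mono-< eu ew |u|<|w| , prefix ,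
     palindrome-prefix⇒suffix (γ-palindrome pu) (γ-palindrome pw) prefix) ,
    quadruple-short {m = length (a ∷ t)} {n = length w} eu ew short) , γ-palindrome pu) ,
  γ-long pu
  where
  w : Word
  w = a ∷ (t ++ p)
  eu : 2 + length (γ (a ∷ t)) ≡ 4 * length (a ∷ t)
  eu = length-γ pu
  ew : 2 + length (γ w) ≡ 4 * length w
  ew = length-γ pw
  prefix : IsPrefix (γ (a ∷ t)) (γ w)
  prefix = γ-prefix pu pw

-- distinct borders have distinct images: they share the first letter of w
γ-injective-on-borders : ∀ {a x u v} → PalBorder (a ∷ x) u → PalBorder (a ∷ x) v → γ u ≡ γ v → u ≡ v
γ-injective-on-borders {u = []} (((() , _) , _) , _) _
γ-injective-on-borders {v = []} _ (((() , _) , _) , _)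
γ-injective-on-borders {u = _ ∷ _} {v = _ ∷ _}
  (((_ , _ , pre-u , _) , _) , pu) (((_ , _ , pre-v , _) , _) , pv)
  with refl ← prefix-head pre-u | refl ← prefix-head pre-v = γ-injective pu pv

-- the one-letter border ā of γ(w), new since images of borders are longer
γ-new-border : ∀ {a x} → IsPalindrome (a ∷ x) → 2 ≤ length (a ∷ x) →
               PalBorder (γ (a ∷ x)) (complement a ∷ [])
γ-new-border {a} {x} pal long =
  ((s≤s z≤n , ≤-trans (s≤s (s≤s z≤n)) 6≤|γw| , γ-head pal ,
    palindrome-prefix⇒suffix refl (γ-palindrome pal) (γ-head pal)) ,
   ≤-trans (s≤s (s≤s (s≤s z≤n))) 6≤|γw|) , refl
  where
  6≤|γw| : 6 ≤ length (γ (a ∷ x))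
  6≤|γw| = +-cancelˡ-≤ 2 6 _ (quadruple-≥ 2 (length-γ pal) long)

Unique-map-on : ∀ {A B : Set} {P : A → Set} (f : A → B) →
                (∀ {x y} → P x → P y → f x ≡ f y → x ≡ y) →
                ∀ {xs} → All P xs → Unique xs → Unique (map f xs)
Unique-map-on f inj [] [] = []
Unique-map-on {P = P} f inj {x ∷ _} (px ∷ pxs) (x∉ ∷ u) = apart pxs x∉ ∷ Unique-map-on f inj pxs u
  where
  apart : ∀ {ys} → All P ys → All (x ≢_) ys → All (f x ≢_) (map f ys)
  apart [] [] = []
  apart (py ∷ pys) (x≢y ∷ x∉ys) = (x≢y ∘ inj px py) ∷ apart pys x∉ys

record Rich (w : Word) (k : ℕ) : Set where
  field
    palindrome : IsPalindrome w
    long       : 2 ≤ length w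
    borders    : List Word
    distinct   : Unique borders
    enough     : k ≤ length borders
    valid      : All (PalBorder w) borders

γ-rich : ∀ {w k} → Rich w k → Rich (γ w) (suc k)
γ-rich {[]} r with () ← Rich.long r
γ-rich {a ∷ x} {k} r = record
  { palindrome = γ-palindrome palindrome
  ; long       = ≤-trans (s≤s (s≤s z≤n)) (γ-long palindrome)
  ; borders    = (complement a ∷ []) ∷ map γ borders
  ; distinct   = map⁺ (All-map (λ q → singleton-not-long (proj₂ (γ-border palindrome q))) valid)
                 ∷ Unique-map-on γ γ-injective-on-borders valid distinct
  ; enough     = s≤s (subst (k ≤_) (sym (length-map γ borders)) enough)
  ; valid      = γ-new-border palindrome long
                 ∷ map⁺ (All-map (proj₁ ∘ γ-border palindrome) valid)
  }
  where
  open Rich r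
  -- images of old borders have length ≥ 2, so differ from the new border ā
  singleton-not-long : ∀ {b : Bit} {c : Word} → 2 ≤ length c → (b ∷ []) ≢ c
  singleton-not-long (s≤s ()) refl

-- a short palindromic border of A₃, all side conditions decided by evaluation
A₃-border : ∀ u y → u ++ y ≡ A3 → IsPalindrome u →
            {_ : True (0 <? length u)} → {_ : True (length u <? 12)} →
            {_ : True (2 * length u <? 12)} → PalBorder A3 u
A₃-border u y e pu {t₀} {t₁} {t₂} =
  ((toWitness t₀ , toWitness t₁ , (y , e) , palindrome-prefix⇒suffix pu refl (y , e)) ,
   toWitness t₂) , pu

rich-A₃ : Rich A3 3
rich-A₃ = record
  { palindrome = refl
  ; long       = s≤s (s≤s z≤n)
  ; borders    = u₁ ∷ u₂ ∷ u₅ ∷ []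
  ; distinct   = ((λ ()) ∷ (λ ()) ∷ []) ∷ ((λ ()) ∷ []) ∷ [] ∷ []
  ; enough     = s≤s (s≤s (s≤s z≤n))
  ; valid      = A₃-border u₁ _ refl refl ∷ A₃-border u₂ _ refl refl ∷ A₃-border u₅ _ refl refl ∷ []
  }
  where
  u₁ u₂ u₅ : Word
  u₁ = b0 ∷ []
  u₂ = b0 ∷ b0 ∷ []
  u₅ = b0 ∷ b0 ∷ b1 ∷ b0 ∷ b0 ∷ []

rich-A' : ∀ k → Rich (A' k) (k + 3)
rich-A' zero = rich-A₃
rich-A' (suc k) = γ-rich (rich-A' k)

lemma18 : (n : ℕ) (h : 3 ≤ n) → IsPalindrome (A n h)
    × Σ (List Word) (λ bs → Unique bs × (n ≤ length bs)
        × All (λ w → IsShortBorder w (A n h) × IsPalindrome w) bs)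
lemma18 n h = palindrome , borders , distinct , subst (_≤ length borders) (m∸n+n≡m h) enough , valid
  where open Rich (rich-A' (n ∸ 3))
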